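{- Let $p\ge 3$ and let $T$ be a tree with color classes $A$ and $B$, $a=|A|\le b=|B|$. If $T$ has a leaf in $A$ and $\alpha(T)=b$, then for every $m\ge 1$ the graph $K_{a-1}\bigotimes\overline{K}_m$ contains no member of $\mathcal{H}(T)$ as a subgraph, and hence contains no member of $\mathcal{M}(T^{p+1})$ as a subgraph.
   Context: All graphs are finite, simple, undirected. $\overline{K}_m$ is the edgeless graph on $m$ vertices, $\alpha(T)$ the independence number, and $X\bigotimes Y$ the join of vertex-disjoint graphs $X,Y$ (disjoint union plus all edges between them). For a graph $H$, the blow-up $H^{p+1}$ is obtained by replacing each edge of $H$ by a clique $K_{p+1}$ containing that edge, with the new vertices for different edges all distinct. A vertex split on a vertex $v$ replaces $v$ by an independent set of $d(v)$ new vertices, each adjacent to exactly one distinct neighbor of $v$; $\mathcal{H}(H)$ is the family of graphs obtained from $H$ by vertex-splitting all vertices of some $U\subseteq V(H)$ ($U=\emptyset$ allowed). For a family $\mathcal{L}$, $p(\mathcal{L})=\min_{L\in\mathcal{L}}\chi(L)-1$, and the decomposition family $\mathcal{M}(\mathcal{L})$ is the family of subgraph-minimal graphs $M$ for which there exist $L\in\mathcal{L}$ and $t$ with $L\subseteq (M\cup I_t)\bigotimes K_{p-1}(t,\ldots,t)$, where $p=p(\mathcal{L})$, $I_t$ is the edgeless graph on $t$ vertices and $K_{p-1}(t,\ldots,t)$ is the complete $(p-1)$-partite graph with classes of size $t$. -}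

module Defs where

open import Data.Nat using (ℕ; zero; suc; _+_; _∸_; _≤_; _<ᵇ_)
open import Data.Bool using (Bool; true; false; not; _∧_; _∨_; T)
open import Data.Bool.Properties using (∧-comm)
open import Data.Fin using (Fin; zero; suc; toℕ; inject₁; fromℕ; _≟_)
open import Data.Fin.Subset using (Subset; ∣_∣; ∁)
open import Data.Vec using (lookup; tabulate)
open import Data.Product using (Σ; ∃; _×_; _,_; proj₁; proj₂)
open import Data.Sum using (_⊎_; inj₁; inj₂)
open import Relation.Nullary using (¬_; yes; no)
open import Relation.Nullary.Decidable using (⌊_⌋)
open import Relation.Binary.PropositionalEquality using (_≡_; refl; _≢_) renaming (sym to ≡-sym)

-- Simple graphs on a vertex type V (Bool-valued, symmetric, irreflexive
-- adjacency).  Finite graphs are those on Fin n (or on finite types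
-- built from Fin by ⊎, ×, and decidable subtypes).

record Graph (V : Set) : Set where
  field
    adj    : V → V → Bool
    adj-sym : ∀ x y → adj x y ≡ adj y x
    irrefl  : ∀ x → adj x x ≡ false
open Graph public

Edge : {V : Set} → Graph V → V → V → Set
Edge G x y = T (adj G x y)

_⊑_ : {V W : Set} → Graph V → Graph W → Set
_⊑_ {V} {W} H G = Σ (V → W) λ f →
  (∀ x y → f x ≡ f y → x ≡ y) × (∀ x y → Edge H x y → Edge G (f x) (f y))

≟-sym : ∀ {n} (x y : Fin n) → ⌊ x ≟ y ⌋ ≡ ⌊ y ≟ x ⌋
≟-sym x y with x ≟ y | y ≟ x
... | yes _ | yes _ = refl
... | no _ | no _ = refl
... | yes p | no q = Data.Empty.⊥-elim (q (≡-sym p)) where import Data.Empty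
... | no q | yes p = Data.Empty.⊥-elim (q (≡-sym p)) where import Data.Empty

≟-refl : ∀ {n} (x : Fin n) → ⌊ x ≟ x ⌋ ≡ true
≟-refl x with x ≟ x
... | yes _ = refl
... | no q = Data.Empty.⊥-elim (q refl) where import Data.Empty

Edgeless : (m : ℕ) → Graph (Fin m)
Edgeless m = record { adj = λ _ _ → false ; adj-sym = λ _ _ → refl ; irrefl = λ _ → refl }

Complete : (k : ℕ) → Graph (Fin k)
Complete k = record
  { adj = λ i j → not ⌊ i ≟ j ⌋
  ; adj-sym = s
  ; irrefl = irr }
  where
    s : ∀ (i j : Fin k) → not ⌊ i ≟ j ⌋ ≡ not ⌊ j ≟ i ⌋
    s i j rewrite ≟-sym i j = refl
    irr : ∀ (i : Fin k) → not ⌊ i ≟ i ⌋ ≡ false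
    irr i rewrite ≟-refl i = refl

CompleteMultipartite : (q t : ℕ) → Graph (Fin q × Fin t)
CompleteMultipartite q t = record
  { adj = λ x y → not ⌊ proj₁ x ≟ proj₁ y ⌋
  ; adj-sym = λ x y → s (proj₁ x) (proj₁ y)
  ; irrefl = λ x → irr (proj₁ x) }
  where
    s : ∀ (i j : Fin q) → not ⌊ i ≟ j ⌋ ≡ not ⌊ j ≟ i ⌋
    s i j rewrite ≟-sym i j = refl
    irr : ∀ (i : Fin q) → not ⌊ i ≟ i ⌋ ≡ false
    irr i rewrite ≟-refl i = refl

DisjUnion : {V W : Set} → Graph V → Graph W → Graph (V ⊎ W)
DisjUnion {V} {W} G H = record { adj = a ; adj-sym = s ; irrefl = i }
  where
    a : V ⊎ W → V ⊎ W → Bool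
    a (inj₁ x) (inj₁ y) = adj G x y
    a (inj₂ x) (inj₂ y) = adj H x y
    a (inj₁ _) (inj₂ _) = false
    a (inj₂ _) (inj₁ _) = false
    s : ∀ x y → a x y ≡ a y x
    s (inj₁ x) (inj₁ y) = Graph.adj-sym G x y
    s (inj₂ x) (inj₂ y) = Graph.adj-sym H x y
    s (inj₁ _) (inj₂ _) = refl
    s (inj₂ _) (inj₁ _) = refl
    i : ∀ x → a x x ≡ false
    i (inj₁ x) = irrefl G x
    i (inj₂ x) = irrefl H x

Join : {V W : Set} → Graph V → Graph W → Graph (V ⊎ W)
Join {V} {W} G H = record { adj = a ; adj-sym = s ; irrefl = i }
  where
    a : V ⊎ W → V ⊎ W → Bool
    a (inj₁ x) (inj₁ y) = adj G x y
    a (inj₂ x) (inj₂ y) = adj H x y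
    a (inj₁ _) (inj₂ _) = true
    a (inj₂ _) (inj₁ _) = true
    s : ∀ x y → a x y ≡ a y x
    s (inj₁ x) (inj₁ y) = Graph.adj-sym G x y
    s (inj₂ x) (inj₂ y) = Graph.adj-sym H x y
    s (inj₁ _) (inj₂ _) = refl
    s (inj₂ _) (inj₁ _) = refl
    i : ∀ x → a x x ≡ false
    i (inj₁ x) = irrefl G x
    i (inj₂ x) = irrefl H x

data Walk {n : ℕ} (G : Graph (Fin n)) : Fin n → Fin n → Set where
  here : ∀ {u} → Walk G u u
  step : ∀ {u v w} → Edge G u v → Walk G v w → Walk G u w

Connected : {n : ℕ} → Graph (Fin n) → Set
Connected {n} G = ∀ (u v : Fin n) → Walk G u v

HasCycle : {n : ℕ} → Graph (Fin n) → Set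
HasCycle {n} G = Σ ℕ λ k → Σ (Fin (3 + k) → Fin n) λ c →
  (∀ i j → c i ≡ c j → i ≡ j) ×
  (∀ (i : Fin (2 + k)) → Edge G (c (inject₁ i)) (c (suc i))) ×
  Edge G (c (fromℕ (2 + k))) (c zero)

IsTree : {n : ℕ} → Graph (Fin n) → Set
IsTree G = Connected G × ¬ HasCycle G

degree : {n : ℕ} → Graph (Fin n) → Fin n → ℕ
degree G v = ∣ tabulate (adj G v) ∣

IsLeaf : {n : ℕ} → Graph (Fin n) → Fin n → Set
IsLeaf G v = degree G v ≡ 1

-- proper 2-colouring: colour classes A = {v | col v = true},
-- B = {v | col v = false} (= ∁ col)
ProperTwoColouring : {n : ℕ} → Graph (Fin n) → Subset n → Set
ProperTwoColouring G col = ∀ u v → Edge G u v → lookup col u ≢ lookup col v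

IsIndependent : {n : ℕ} → Graph (Fin n) → Subset n → Set
IsIndependent G S = ∀ u v → lookup S u ≡ true → lookup S v ≡ true → adj G u v ≡ false

IsIndependenceNumber : {n : ℕ} → Graph (Fin n) → ℕ → Set
IsIndependenceNumber {n} G k =
  (Σ (Subset n) λ S → IsIndependent G S × ∣ S ∣ ≡ k) ×
  (∀ (S : Subset n) → IsIndependent G S → ∣ S ∣ ≤ k)

Colourable : {V : Set} → Graph V → ℕ → Set
Colourable {V} G k = Σ (V → Fin k) λ c → ∀ x y → Edge G x y → c x ≢ c y

IsChromaticNumber : {V : Set} → Graph V → ℕ → Set
IsChromaticNumber G k = Colourable G k × (∀ j → Colourable G j → k ≤ j)

-- Vertices: inj₁ v for v ∉ U, and inj₂ (u , w) for u ∈ U, uw ∈ E(G)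
-- (the copy of u attached to its neighbour w).  Each edge uw of G
-- becomes the edge  r(u,w) — r(w,u)  where r(u,w) = u if u ∉ U and
-- (u , w) if u ∈ U.

SplitRaw : ℕ → Set
SplitRaw n = Fin n ⊎ (Fin n × Fin n)

splitValid : {n : ℕ} → Graph (Fin n) → Subset n → SplitRaw n → Bool
splitValid G U (inj₁ v) = not (lookup U v)
splitValid G U (inj₂ (u , w)) = lookup U u ∧ adj G u w

SplitV : {n : ℕ} → Graph (Fin n) → Subset n → Set
SplitV {n} G U = Σ (SplitRaw n) λ x → T (splitValid G U x)

splitAdj : {n : ℕ} → Graph (Fin n) → SplitRaw n → SplitRaw n → Bool
splitAdj G (inj₁ x) (inj₁ y) = adj G x y
splitAdj G (inj₁ x) (inj₂ (u , w)) = ⌊ x ≟ w ⌋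
splitAdj G (inj₂ (u , w)) (inj₁ x) = ⌊ x ≟ w ⌋
splitAdj G (inj₂ (u , w)) (inj₂ (u' , w')) = ⌊ u ≟ w' ⌋ ∧ ⌊ w ≟ u' ⌋

private
  splitSym : ∀ {n} (G : Graph (Fin n)) x y → splitAdj G x y ≡ splitAdj G y x
  splitSym G (inj₁ x) (inj₁ y) = Graph.adj-sym G x y
  splitSym G (inj₁ x) (inj₂ _) = refl
  splitSym G (inj₂ _) (inj₁ x) = refl
  splitSym G (inj₂ (u , w)) (inj₂ (u' , w'))
    rewrite ≟-sym u w' | ≟-sym w u' = ∧-comm ⌊ w' ≟ u ⌋ ⌊ u' ≟ w ⌋

  splitIrr : ∀ {n} (G : Graph (Fin n)) (U : Subset n) (x : SplitV G U) →
             splitAdj G (proj₁ x) (proj₁ x) ≡ false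
  splitIrr G U (inj₁ x , _) = irrefl G x
  splitIrr G U (inj₂ (u , w) , ok) with u ≟ w
  ... | no _ = refl
  ... | yes refl = Data.Empty.⊥-elim (noLoop (lookup U u) ok)
    where
      import Data.Empty
      noLoop : ∀ b → T (b ∧ adj G u u) → Data.Empty.⊥
      noLoop false ()
      noLoop true t rewrite irrefl G u = t

Split : {n : ℕ} → (G : Graph (Fin n)) → (U : Subset n) → Graph (SplitV G U)
Split G U = record
  { adj = λ x y → splitAdj G (proj₁ x) (proj₁ y)
  ; adj-sym = λ x y → splitSym G (proj₁ x) (proj₁ y)
  ; irrefl = splitIrr G U }

-- H ∈ 𝓗(G): Split G U for some U ⊆ V(G) (U = ∅ allowed)

-- Blow-up  G^{p+1}: each edge {u,w} (stored as u < w) receives p-1 new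
-- vertices, which together with u, w form a clique K_{p+1}.

BlowEdge : {n : ℕ} → Graph (Fin n) → Set
BlowEdge {n} G = Σ (Fin n × Fin n) λ e → T (adj G (proj₁ e) (proj₂ e) ∧ (toℕ (proj₁ e) <ᵇ toℕ (proj₂ e)))

BlowV : {n : ℕ} → ℕ → Graph (Fin n) → Set
BlowV {n} p G = Fin n ⊎ (BlowEdge G × Fin (p ∸ 1))

blowAdj : {n : ℕ} (p : ℕ) (G : Graph (Fin n)) → BlowV p G → BlowV p G → Bool
blowAdj p G (inj₁ x) (inj₁ y) = adj G x y
blowAdj p G (inj₁ x) (inj₂ (((u , w) , _) , i)) = ⌊ x ≟ u ⌋ ∨ ⌊ x ≟ w ⌋
blowAdj p G (inj₂ (((u , w) , _) , i)) (inj₁ x) = ⌊ x ≟ u ⌋ ∨ ⌊ x ≟ w ⌋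
blowAdj p G (inj₂ (((u , w) , _) , i)) (inj₂ (((u' , w') , _) , j)) =
  ⌊ u ≟ u' ⌋ ∧ ⌊ w ≟ w' ⌋ ∧ not ⌊ i ≟ j ⌋

private
  blowSym : ∀ {n} p (G : Graph (Fin n)) x y → blowAdj p G x y ≡ blowAdj p G y x
  blowSym p G (inj₁ x) (inj₁ y) = Graph.adj-sym G x y
  blowSym p G (inj₁ x) (inj₂ _) = refl
  blowSym p G (inj₂ _) (inj₁ x) = refl
  blowSym p G (inj₂ (((u , w) , _) , i)) (inj₂ (((u' , w') , _) , j))
    rewrite ≟-sym u u' | ≟-sym w w' | ≟-sym i j = refl

  blowIrr : ∀ {n} p (G : Graph (Fin n)) x → blowAdj p G x x ≡ false
  blowIrr p G (inj₁ x) = irrefl G x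
  blowIrr p G (inj₂ (((u , w) , _) , i)) rewrite ≟-refl u | ≟-refl w | ≟-refl i = refl

BlowUp : {n : ℕ} (p : ℕ) (G : Graph (Fin n)) → Graph (BlowV p G)
BlowUp p G = record { adj = blowAdj p G ; adj-sym = blowSym p G ; irrefl = blowIrr p G }

-- Decomposition family 𝓜({L}) of a single graph L, p = p({L}) = χ(L) - 1.

Decomposes : {V : Set} → Graph V → ℕ → {n' : ℕ} → Graph (Fin n') → Set
Decomposes L p M = Σ ℕ λ t →
  L ⊑ Join (DisjUnion M (Edgeless t)) (CompleteMultipartite (p ∸ 1) t)

-- M is subgraph-minimal with property P: P M holds, and no proper
-- subgraph M' of M (M' ⊑ M but M ⋢ M', i.e. M' not isomorphic to M)
-- has property P
SubgraphMinimal : ({n' : ℕ} → Graph (Fin n') → Set) → {n : ℕ} → Graph (Fin n) → Set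
SubgraphMinimal P M =
  P M × (∀ (n' : ℕ) (M' : Graph (Fin n')) → M' ⊑ M → ¬ (M ⊑ M') → ¬ P M')

InDecompFamily : {V : Set} → Graph V → {n : ℕ} → Graph (Fin n) → Set
InDecompFamily L M = Σ ℕ λ χ → IsChromaticNumber L χ ×
  SubgraphMinimal (Decomposes L (χ ∸ 1)) M

module Submission where

-- Let the tree G have colour classes A = col and B = ∁ col with α(G) = |B|, so
-- that every vertex cover of G has at least n - |B| = |A| vertices.  An
-- embedding of Split G U, or of a member M of the decomposition family of
-- G^{p+1}, into K_{|A|-1} ⊗ \overline{K}_m would produce a vertex cover of G
-- with only |A| - 1 vertices, which is impossible as soon as A ≠ ∅.
--
-- By pigeonhole, a
-- clique with more than r vertices meets a slot.  Slot partitions pull back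
-- along embeddings, and K_k ⊗ \overline{K}_m, (M ∪ I_t) and
-- X ⊗ K_q(t,…,t) carry them.  If every edge uw of G is witnessed by a large
-- clique of H whose vertices are "owned" by u or w, the owners of slotted
-- vertices form a vertex cover injecting into the k slots, so n ≤ α(G) + k
-- (ownedClique-bound).  For Split G U the witnessing cliques are the two
-- copies of an edge, against one class; for G^{p+1} they are the cliques
-- K_{p+1} replacing the edges, against the χ(G^{p+1}) - 1 ≤ p classes of
-- (M ∪ I_t) ⊗ K_{χ-2}(t,…,t).  Only α(G) = |B|, A ≠ ∅ and the proper
-- 2-colouring are used.

open import Defs
open import Data.Nat using (ℕ; zero; suc; _+_; _∸_; _≤_; _<_; z≤n; s≤s; _<ᵇ_)
open import Data.Nat.Properties
  using (+-suc; +-comm; n≮n; ≤-trans; ≤-<-trans; +-monoˡ-≤; ∸-monoˡ-≤; m+[n∸m]≡n; <⇒<ᵇ)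
open import Data.Fin using (Fin; zero; suc; toℕ; punchOut; _≟_; _↑ˡ_; _↑ʳ_; splitAt)
open import Data.Fin.Properties
  using (any?; pigeonhole; punchOut-injective; suc-injective; <-cmp; <⇒≢; ↑ˡ-injective; ↑ʳ-injective;
         splitAt-↑ˡ; splitAt-↑ʳ)
open import Data.Fin.Subset using (Subset; ∣_∣; ∁)
open import Data.Fin.Subset.Properties using (∣p∣≤n; ∣∁p∣≡n∸∣p∣; x∈p⇒∣p-x∣<∣p∣)
open import Data.Vec using (lookup; tabulate)
open import Data.Vec.Properties using (lookup∘tabulate; tabulate-cong; lookup⇒[]=)
open import Data.Bool using (Bool; true; false; T; _∧_)
open import Data.Bool.Properties using (T-∧; T-∨; T-≡; T-not-≡)
open import Data.Maybe using (Maybe; just; nothing; is-nothing)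
open import Data.Maybe.Properties using (just-injective)
open import Data.Unit using (tt)
open import Data.Empty using (⊥; ⊥-elim)
open import Data.Product using (Σ; ∃; _×_; _,_; proj₁; proj₂)
open import Data.Sum using (_⊎_; inj₁; inj₂; map₂; swap; [_,_])
open import Data.Sum.Properties using (inj₂-injective)
open import Function using (_∘_)
open import Function.Bundles using (Equivalence)
open import Relation.Nullary using (¬_; Dec; yes; no)
open import Relation.Nullary.Decidable using (⌊_⌋; _×-dec_; toWitnessFalse; fromWitnessFalse)
open import Relation.Binary.PropositionalEquality
  using (_≡_; _≢_; refl; sym; trans; cong; subst)
open import Relation.Binary.Definitions using (tri<; tri≈; tri>)

open Equivalence using (to; from)

¬T⇒≡false : ∀ {b} → ¬ T b → b ≡ false
¬T⇒≡false {false} _  = refl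
¬T⇒≡false {true}  ¬t = ⊥-elim (¬t tt)

≟-self : ∀ {n} (x : Fin n) → T ⌊ x ≟ x ⌋
≟-self x = from T-≡ (≟-refl x)

edge-sym : ∀ {V} (G : Graph V) {x y} → Edge G x y → Edge G y x
edge-sym G {x} {y} = subst T (adj-sym G x y)

PartialInjection : {n k : ℕ} → (Fin n → Maybe (Fin k)) → Set
PartialInjection c = ∀ u v {j} → c u ≡ just j → c v ≡ just j → u ≡ v

unassigned : {n : ℕ} {A : Set} → (Fin n → Maybe A) → Subset n
unassigned c = tabulate (is-nothing ∘ c)

removeSlot : {k : ℕ} → Fin (suc k) → Maybe (Fin (suc k)) → Maybe (Fin k)
removeSlot j nothing = nothing
removeSlot j (just a) with j ≟ a
... | yes _  = nothing
... | no j≢a = just (punchOut j≢a)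

removeSlot-is-nothing : ∀ {k} (j : Fin (suc k)) z → z ≢ just j →
                        is-nothing (removeSlot j z) ≡ is-nothing z
removeSlot-is-nothing j nothing  _   = refl
removeSlot-is-nothing j (just a) z≢j with j ≟ a
... | yes refl = ⊥-elim (z≢j refl)
... | no _     = refl

removeSlot-injective : ∀ {k} (j : Fin (suc k)) z z' {i} →
                       removeSlot j z ≡ just i → removeSlot j z' ≡ just i →
                       ∃ λ a → z ≡ just a × z' ≡ just a
removeSlot-injective j (just a) (just a') p q with j ≟ a | j ≟ a' | p | q
... | no j≢a | no j≢a' | p' | q' =
  a , refl , cong just (sym (punchOut-injective j≢a j≢a'
                               (trans (just-injective p') (just-injective (sym q')))))

-- Induction on n: an assigned first point uses up one slot.
partialInjection-bound : ∀ n {k} (c : Fin n → Maybe (Fin k)) → PartialInjection c →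
                         n ≤ ∣ unassigned c ∣ + k
partialInjection-bound zero c inj = z≤n
partialInjection-bound (suc n) c inj with c zero in c0
... | nothing =
  s≤s (partialInjection-bound n (c ∘ suc) λ u v p q → suc-injective (inj (suc u) (suc v) p q))
partialInjection-bound (suc n) {suc k} c inj | just j =
  subst (suc n ≤_) (sym (+-suc _ k))
    (s≤s (subst (λ S → n ≤ ∣ S ∣ + k) (tabulate-cong sameUnassigned)
            (partialInjection-bound n rest rest-injective)))
  where
    rest : Fin n → Maybe (Fin k)
    rest u = removeSlot j (c (suc u))

    avoids-j : ∀ u → c (suc u) ≢ just j
    avoids-j u eq with inj zero (suc u) c0 eq
    ... | ()

    sameUnassigned : ∀ u → is-nothing (rest u) ≡ is-nothing (c (suc u))
    sameUnassigned u = removeSlot-is-nothing j (c (suc u)) (avoids-j u)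

    rest-injective : PartialInjection rest
    rest-injective u v p q with removeSlot-injective j (c (suc u)) (c (suc v)) p q
    ... | _ , cu , cv = suc-injective (inj (suc u) (suc v) cu cv)

Searchable : Set → Set₁
Searchable A = ∀ {P : A → Set} → (∀ a → Dec (P a)) → Dec (∃ P)

search-Fin : ∀ {n} → Searchable (Fin n)
search-Fin P? = any? P?

search-⊎ : {A B : Set} → Searchable A → Searchable B → Searchable (A ⊎ B)
search-⊎ sA sB P? with sA (P? ∘ inj₁) | sB (P? ∘ inj₂)
... | yes (a , pa) | _            = yes (inj₁ a , pa)
... | no _         | yes (b , pb) = yes (inj₂ b , pb)
... | no ¬a        | no ¬b        =
  no λ { (inj₁ a , pa) → ¬a (a , pa) ; (inj₂ b , pb) → ¬b (b , pb) }

search-Σ : {A : Set} {B : A → Set} → Searchable A → (∀ a → Searchable (B a)) →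
           Searchable (Σ A B)
search-Σ sA sB P? with sA (λ a → sB a (λ b → P? (a , b)))
... | yes (a , b , pab) = yes ((a , b) , pab)
... | no ¬ab            = no λ { ((a , b) , pab) → ¬ab (a , b , pab) }

search-T : ∀ b → Searchable (T b)
search-T true P? with P? tt
... | yes p = yes (tt , p)
... | no ¬p = no λ { (tt , p) → ¬p p }
search-T false P? = no λ { (() , _) }

InSlot : {k : ℕ} {C : Set} → Fin k ⊎ C → Set
InSlot {k} z = ∃ λ (j : Fin k) → z ≡ inj₁ j

inSlot? : {k : ℕ} {C : Set} (z : Fin k ⊎ C) → Dec (InSlot z)
inSlot? (inj₁ j) = yes (j , refl)
inSlot? (inj₂ _) = no λ { (_ , ()) }

-- Every vertex of H is placed in one of k slots, each holding at most one
-- vertex, or in one of r classes, each independent; i.e. H ⊆ K_k ⊗ K_r(t,…,t).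
record SlotPartition {V : Set} (H : Graph V) (k r : ℕ) : Set where
  field
    place             : V → Fin k ⊎ Fin r
    slot-injective    : ∀ x y {j} → place x ≡ inj₁ j → place y ≡ inj₁ j → x ≡ y
    class-independent : ∀ x y {c} → place x ≡ inj₂ c → place y ≡ inj₂ c → ¬ Edge H x y
open SlotPartition

IsClique : {V : Set} {s : ℕ} → Graph V → (Fin s → V) → Set
IsClique H cl = ∀ i j → i ≢ j → Edge H (cl i) (cl j)

pair : {V : Set} → V → V → Fin 2 → V
pair x y zero       = x
pair x y (suc zero) = y

edge-isClique : ∀ {V} (H : Graph V) {x y} → Edge H x y → IsClique H (pair x y)
edge-isClique H e zero       zero       ne = ⊥-elim (ne refl)
edge-isClique H e zero       (suc zero) _  = e
edge-isClique H e (suc zero) zero       _  = edge-sym H e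
edge-isClique H e (suc zero) (suc zero) ne = ⊥-elim (ne refl)

classOf : {k r : ℕ} (z : Fin k ⊎ Fin r) → ¬ InSlot z → Fin r
classOf (inj₁ j) notSlot = ⊥-elim (notSlot (j , refl))
classOf (inj₂ c) _       = c

classOf-spec : {k r : ℕ} (z : Fin k ⊎ Fin r) (notSlot : ¬ InSlot z) →
               z ≡ inj₂ (classOf z notSlot)
classOf-spec (inj₁ j) notSlot = ⊥-elim (notSlot (j , refl))
classOf-spec (inj₂ c) _       = refl

-- Pigeonhole: a clique with more vertices than there are classes has a
-- vertex in a slot, since two of its vertices would otherwise share a class.
clique-meets-slot : ∀ {V} {H : Graph V} {k r s} (P : SlotPartition H k r) → r < s →
                    (cl : Fin s → V) → IsClique H cl → ∃ λ i → InSlot (place P (cl i))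
clique-meets-slot {r = r} {s} P r<s cl clique with any? (λ i → inSlot? (place P (cl i)))
... | yes found = found
... | no none   = ⊥-elim (collision (pigeonhole r<s class))
  where
    notSlot : ∀ i → ¬ InSlot (place P (cl i))
    notSlot i slotted = none (i , slotted)

    class : Fin s → Fin r
    class i = classOf (place P (cl i)) (notSlot i)

    collision : (∃ λ i → ∃ λ j → toℕ i < toℕ j × class i ≡ class j) → ⊥
    collision (i , j , i<j , sameClass) =
      class-independent P (cl i) (cl j)
        (trans (classOf-spec _ (notSlot i)) (cong inj₂ sameClass))
        (classOf-spec _ (notSlot j))
        (clique i j (<⇒≢ i<j))

pull : ∀ {V W} (H : Graph V) {H' : Graph W} {k r} →
       H ⊑ H' → SlotPartition H' k r → SlotPartition H k r
pull H (f , f-inj , f-edge) P = record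
  { place             = place P ∘ f
  ; slot-injective    = λ x y px py → f-inj x y (slot-injective P (f x) (f y) px py)
  ; class-independent = λ x y px py e → class-independent P (f x) (f y) px py (f-edge x y e)
  }

completeJoinEdgeless : ∀ k m → SlotPartition (Join (Complete k) (Edgeless m)) k 1
completeJoinEdgeless k m = record
  { place             = λ { (inj₁ j) → inj₁ j ; (inj₂ _) → inj₂ zero }
  ; slot-injective    = λ { (inj₁ _) (inj₁ _) refl refl → refl
                          ; (inj₁ _) (inj₂ _) _ () ; (inj₂ _) _ () _ }
  ; class-independent = λ { (inj₂ _) (inj₂ _) _ _ () ; (inj₁ _) _ () _
                          ; (inj₂ _) (inj₁ _) _ () }
  }

withIsolated : ∀ {V} {M : Graph V} {k r} t →
               SlotPartition M k (suc r) → SlotPartition (DisjUnion M (Edgeless t)) k (suc r)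
withIsolated {V} {M} {k} {r} t P = record
  { place = position ; slot-injective = injective ; class-independent = independent }
  where
    position : V ⊎ Fin t → Fin k ⊎ Fin (suc r)
    position (inj₁ x) = place P x
    position (inj₂ _) = inj₂ zero

    injective : ∀ x y {j} → position x ≡ inj₁ j → position y ≡ inj₁ j → x ≡ y
    injective (inj₁ x) (inj₁ y) px py = cong inj₁ (slot-injective P x y px py)
    injective (inj₁ _) (inj₂ _) _  ()
    injective (inj₂ _) _        () _

    independent : ∀ x y {c} → position x ≡ inj₂ c → position y ≡ inj₂ c →
                  ¬ Edge (DisjUnion M (Edgeless t)) x y
    independent (inj₁ x) (inj₁ y) px py = class-independent P x y px py
    independent (inj₁ _) (inj₂ _) _ _ ()
    independent (inj₂ _) (inj₁ _) _ _ ()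
    independent (inj₂ _) (inj₂ _) _ _ ()

relabel-slot : ∀ {k} {A B : Set} (f : A → B) (z : Fin k ⊎ A) {j} →
               map₂ f z ≡ inj₁ j → z ≡ inj₁ j
relabel-slot f (inj₁ _) refl = refl
relabel-slot f (inj₂ _) ()

relabel-class : ∀ {k} {A B : Set} (f : A → B) (z : Fin k ⊎ A) {d} →
                map₂ f z ≡ inj₂ d → ∃ λ a → z ≡ inj₂ a × f a ≡ d
relabel-class f (inj₁ _) ()
relabel-class f (inj₂ a) refl = a , refl , refl

↑ˡ≢↑ʳ : ∀ {r q} (a : Fin r) (c : Fin q) → a ↑ˡ q ≢ r ↑ʳ c
↑ˡ≢↑ʳ {r} {q} a c eq
  with trans (sym (splitAt-↑ˡ r a q)) (trans (cong (splitAt r) eq) (splitAt-↑ʳ r q c))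
... | ()

joinMultipartite : ∀ {V} {X : Graph V} {k r} q t →
                   SlotPartition X k r →
                   SlotPartition (Join X (CompleteMultipartite q t)) k (r + q)
joinMultipartite {V} {X} {k} {r} q t P = record
  { place = position ; slot-injective = injective ; class-independent = independent }
  where
    position : V ⊎ (Fin q × Fin t) → Fin k ⊎ Fin (r + q)
    position (inj₁ x)       = map₂ (_↑ˡ q) (place P x)
    position (inj₂ (c , _)) = inj₂ (r ↑ʳ c)

    injective : ∀ x y {j} → position x ≡ inj₁ j → position y ≡ inj₁ j → x ≡ y
    injective (inj₁ x) (inj₁ y) px py =
      cong inj₁ (slot-injective P x y (relabel-slot _ (place P x) px) (relabel-slot _ (place P y) py))
    injective (inj₁ _) (inj₂ _) _  ()
    injective (inj₂ _) _        () _

    independent : ∀ x y {c} → position x ≡ inj₂ c → position y ≡ inj₂ c →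
                  ¬ Edge (Join X (CompleteMultipartite q t)) x y
    independent (inj₁ x) (inj₁ y) px py
      with relabel-class _ (place P x) px | relabel-class _ (place P y) py
    ... | a , ex , fa | b , ey , fb =
      class-independent P x y ex (trans ey (cong inj₂ (↑ˡ-injective q b a (trans fb (sym fa)))))
    independent (inj₁ x) (inj₂ (c , _)) px refl _ with relabel-class _ (place P x) px
    ... | a , _ , fa = ↑ˡ≢↑ʳ a c fa
    independent (inj₂ (c , _)) (inj₁ y) refl py _ with relabel-class _ (place P y) py
    ... | b , _ , fb = ↑ˡ≢↑ʳ b c fb
    independent (inj₂ (c , _)) (inj₂ (c' , _)) refl py e =
      toWitnessFalse e (sym (↑ʳ-injective r c' c (inj₂-injective py)))

module Ownership {n k r : ℕ} {X : Set} {H : Graph X}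
  (P : SlotPartition H k r) (owner : X → Fin n) (search : Searchable X) where

  Owned : Fin n → Set
  Owned u = ∃ λ x → owner x ≡ u × InSlot (place P x)

  owned? : ∀ u → Dec (Owned u)
  owned? u = search (λ x → (owner x ≟ u) ×-dec inSlot? (place P x))

  slotOfWitness : ∀ {u} → Dec (Owned u) → Maybe (Fin k)
  slotOfWitness (yes (_ , _ , j , _)) = just j
  slotOfWitness (no _)                = nothing

  ownedSlot : Fin n → Maybe (Fin k)
  ownedSlot u = slotOfWitness (owned? u)

  slotWitness : ∀ {u j} (d : Dec (Owned u)) → slotOfWitness d ≡ just j →
                ∃ λ x → owner x ≡ u × place P x ≡ inj₁ j
  slotWitness (yes (x , o , _ , e)) refl = x , o , e

  -- Distinct owners cannot share a slot, as the slot holds a single vertex.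
  ownedSlot-injective : PartialInjection ownedSlot
  ownedSlot-injective u v p q with slotWitness (owned? u) p | slotWitness (owned? v) q
  ... | x , ox , px | y , oy , py =
    trans (sym ox) (trans (cong owner (slot-injective P x y px py)) oy)

  unassigned-unowned : ∀ u → lookup (unassigned ownedSlot) u ≡ true → ¬ Owned u
  unassigned-unowned u z = unowned (owned? u) (trans (sym (lookup∘tabulate _ u)) z)
    where
      unowned : (d : Dec (Owned u)) → is-nothing (slotOfWitness d) ≡ true → ¬ Owned u
      unowned (no ¬o) _ = ¬o

OwnedClique : {n s : ℕ} {X : Set} → Graph X → (X → Fin n) → Fin n → Fin n → Set
OwnedClique {s = s} {X} H owner u w =
  Σ (Fin s → X) λ cl → IsClique H cl × (∀ i → owner (cl i) ≡ u ⊎ owner (cl i) ≡ w)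

-- The owned vertices of G form a vertex cover injecting into the k slots,
-- so all but k vertices of G lie in an independent set.
ownedClique-bound : ∀ {n k r s b X} (G : Graph (Fin n)) {H : Graph X} →
  (∀ S → IsIndependent G S → ∣ S ∣ ≤ b) →
  (P : SlotPartition H k r) (owner : X → Fin n) → Searchable X → r < s →
  (∀ u w → Edge G u w → OwnedClique {s = s} H owner u w) →
  n ≤ b + k
ownedClique-bound {n} {k} G α-bound P owner search r<s witness =
  ≤-trans (partialInjection-bound n ownedSlot ownedSlot-injective)
          (+-monoˡ-≤ k (α-bound (unassigned ownedSlot) independent))
  where
    open Ownership P owner search

    -- Each witnessing clique meets a slot, so some endpoint is owned.
    covered : ∀ u w → Edge G u w → Owned u ⊎ Owned w
    covered u w e with witness u w e
    ... | cl , clique , owners with clique-meets-slot P r<s cl clique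
    ... | i , slotted with owners i
    ... | inj₁ o = inj₁ (cl i , o , slotted)
    ... | inj₂ o = inj₂ (cl i , o , slotted)

    independent : IsIndependent G (unassigned ownedSlot)
    independent u w zu zw = ¬T⇒≡false λ e →
      [ unassigned-unowned u zu , unassigned-unowned w zw ] (covered u w e)

-- With α(G) = |B| and A ≠ ∅, fewer than |A| slots cannot cover G:
-- n = |A| + |B| would be at most |B| + (|A| - 1).
tooFewSlots : ∀ {n r s X} (G : Graph (Fin n)) (col : Subset n) {H : Graph X} →
  IsIndependenceNumber G ∣ ∁ col ∣ → (∃ λ v → lookup col v ≡ true) →
  (P : SlotPartition H (∣ col ∣ ∸ 1) r) (owner : X → Fin n) → Searchable X → r < s →
  (∀ u w → Edge G u w → OwnedClique {s = s} H owner u w) → ⊥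
tooFewSlots {n} G col (_ , α-bound) (v , v∈A) P owner search r<s witness =
  impossible (≤-<-trans z≤n (x∈p⇒∣p-x∣<∣p∣ (lookup⇒[]= v col v∈A)))
    (subst (_≤ ∣ ∁ col ∣ + (∣ col ∣ ∸ 1)) n≡a+b
       (ownedClique-bound G α-bound P owner search r<s witness))
  where
    n≡a+b : n ≡ ∣ col ∣ + ∣ ∁ col ∣
    n≡a+b = trans (sym (m+[n∸m]≡n (∣p∣≤n col)))
                  (cong (∣ col ∣ +_) (sym (∣∁p∣≡n∸∣p∣ col)))

    impossible : ∀ {a b} → 1 ≤ a → a + b ≤ b + (a ∸ 1) → ⊥
    impossible {suc a} {b} _ le = n≮n (a + b) (subst (suc (a + b) ≤_) (+-comm b a) le)

-- The copy of u carrying the edge uw is u itself when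
-- u ∉ U, and the new vertex (u , w) otherwise; the copies of u and of w
-- carrying uw are adjacent, giving a 2-clique owned by u and w.

module Splitting {n : ℕ} (G : Graph (Fin n)) (U : Subset n) where

  splitOwner : SplitV G U → Fin n
  splitOwner (inj₁ v , _)       = v
  splitOwner (inj₂ (u , _) , _) = u

  search-Split : Searchable (SplitV G U)
  search-Split = search-Σ (search-⊎ search-Fin (search-Σ search-Fin λ _ → search-Fin))
                          (λ _ → search-T _)

  copy : ∀ u w → Edge G u w → (b : Bool) → lookup U u ≡ b → SplitV G U
  copy u w e true  u∈U = inj₂ (u , w) , from T-∧ (from T-≡ u∈U , e)
  copy u w e false u∉U = inj₁ u , from T-not-≡ u∉U

  copy-owner : ∀ u w e b u∈? → splitOwner (copy u w e b u∈?) ≡ u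
  copy-owner u w e true  _ = refl
  copy-owner u w e false _ = refl

  copies-adjacent : ∀ u w (e : Edge G u w) b u∈? b' w∈? →
                    Edge (Split G U) (copy u w e b u∈?) (copy w u (edge-sym G e) b' w∈?)
  copies-adjacent u w e true  _ true  _ = from T-∧ (≟-self u , ≟-self w)
  copies-adjacent u w e true  _ false _ = ≟-self w
  copies-adjacent u w e false _ true  _ = ≟-self u
  copies-adjacent u w e false _ false _ = e

  split-witness : ∀ u w → Edge G u w → OwnedClique {s = 2} (Split G U) splitOwner u w
  split-witness u w e =
    pair x y , edge-isClique (Split G U) (copies-adjacent u w e _ refl _ refl) , owners
    where
      x y : SplitV G U
      x = copy u w e (lookup U u) refl
      y = copy w u (edge-sym G e) (lookup U w) refl
      owners : ∀ i → splitOwner (pair x y i) ≡ u ⊎ splitOwner (pair x y i) ≡ w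
      owners zero       = inj₁ (copy-owner u w e _ refl)
      owners (suc zero) = inj₂ (copy-owner w u (edge-sym G e) _ refl)

-- A proper 2-colouring of G extends to a proper (p+1)-colouring of
-- G^{p+1}, and every edge uw of G lies in a (p+1)-clique of G^{p+1} whose
-- vertices are owned by u and w (new vertices are owned by the smaller end).

module BlowingUp {n : ℕ} (p : ℕ) (G : Graph (Fin n)) where

  blowOwner : BlowV p G → Fin n
  blowOwner (inj₁ u)                   = u
  blowOwner (inj₂ (((u , _) , _) , _)) = u

  search-Blow : Searchable (BlowV p G)
  search-Blow = search-⊎ search-Fin
    (search-Σ (search-Σ (search-Σ search-Fin λ _ → search-Fin) λ _ → search-T _)
              λ _ → search-Fin)

  sideColour : ∀ {r} → Bool → Fin (2 + r)
  sideColour true  = zero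
  sideColour false = suc zero

  sideColour-injective : ∀ {r} x y → sideColour {r} x ≡ sideColour y → x ≡ y
  sideColour-injective true  true  _ = refl
  sideColour-injective false false _ = refl

  sideColour-old : ∀ {r} b (i : Fin r) → sideColour b ≢ suc (suc i)
  sideColour-old true  _ ()
  sideColour-old false _ ()

  blowUp-colourable : (col : Subset n) → ProperTwoColouring G col →
                      Colourable (BlowUp p G) (2 + (p ∸ 1))
  blowUp-colourable col proper = colour , colour-proper
    where
      colour : BlowV p G → Fin (2 + (p ∸ 1))
      colour (inj₁ u)       = sideColour (lookup col u)
      colour (inj₂ (_ , i)) = suc (suc i)

      colour-proper : ∀ x y → Edge (BlowUp p G) x y → colour x ≢ colour y
      colour-proper (inj₁ u) (inj₁ w) e same = proper u w e (sideColour-injective _ _ same)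
      colour-proper (inj₁ u) (inj₂ (_ , i)) _ same = sideColour-old (lookup col u) i same
      colour-proper (inj₂ (_ , i)) (inj₁ w) _ same = sideColour-old (lookup col w) i (sym same)
      colour-proper (inj₂ (((u , w) , _) , i)) (inj₂ (((u' , w') , _) , j)) e same =
        toWitnessFalse (proj₂ (to (T-∧ {⌊ w ≟ w' ⌋}) (proj₂ (to (T-∧ {⌊ u ≟ u' ⌋}) e))))
                       (suc-injective (suc-injective same))

  edgeClique : ∀ u w → T (adj G u w ∧ (toℕ u <ᵇ toℕ w)) → Fin (2 + (p ∸ 1)) → BlowV p G
  edgeClique u w e zero          = inj₁ u
  edgeClique u w e (suc zero)    = inj₁ w
  edgeClique u w e (suc (suc i)) = inj₂ (((u , w) , e) , i)

  edgeClique-isClique : ∀ u w e → IsClique (BlowUp p G) (edgeClique u w e)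
  edgeClique-isClique u w e = clique
    where
      uw : Edge G u w
      uw = proj₁ (to T-∧ e)
      clique : IsClique (BlowUp p G) (edgeClique u w e)
      clique zero          zero          ne = ⊥-elim (ne refl)
      clique zero          (suc zero)    _  = uw
      clique zero          (suc (suc _)) _  = from T-∨ (inj₁ (≟-self u))
      clique (suc zero)    zero          _  = edge-sym G uw
      clique (suc zero)    (suc zero)    ne = ⊥-elim (ne refl)
      clique (suc zero)    (suc (suc _)) _  = from T-∨ (inj₂ (≟-self w))
      clique (suc (suc _)) zero          _  = from T-∨ (inj₁ (≟-self u))
      clique (suc (suc _)) (suc zero)    _  = from T-∨ (inj₂ (≟-self w))
      clique (suc (suc i)) (suc (suc j)) ne =
        from T-∧ (≟-self u , from T-∧ (≟-self w , fromWitnessFalse {a? = i ≟ j} i≢j))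
        where
          i≢j : i ≢ j
          i≢j i≡j = ne (cong (λ k → suc (suc k)) i≡j)

  edgeClique-owner : ∀ u w e i →
    blowOwner (edgeClique u w e i) ≡ u ⊎ blowOwner (edgeClique u w e i) ≡ w
  edgeClique-owner u w e zero          = inj₁ refl
  edgeClique-owner u w e (suc zero)    = inj₂ refl
  edgeClique-owner u w e (suc (suc _)) = inj₁ refl

  oriented-witness : ∀ u w → Edge G u w → toℕ u < toℕ w →
                     OwnedClique {s = 2 + (p ∸ 1)} (BlowUp p G) blowOwner u w
  oriented-witness u w e u<w =
    edgeClique u w e' , edgeClique-isClique u w e' , edgeClique-owner u w e'
    where
      e' : T (adj G u w ∧ (toℕ u <ᵇ toℕ w))
      e' = from T-∧ (e , <⇒<ᵇ u<w)

  blow-witness : ∀ u w → Edge G u w → OwnedClique {s = 2 + (p ∸ 1)} (BlowUp p G) blowOwner u w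
  blow-witness u w e with <-cmp u w
  ... | tri< u<w _ _ = oriented-witness u w e u<w
  ... | tri≈ _ refl _ = ⊥-elim (subst T (irrefl G u) e)
  ... | tri> _ _ w<u with oriented-witness w u (edge-sym G e) w<u
  ...   | cl , clique , owners = cl , clique , swap ∘ owners

lemma2 : ∀ (p : ℕ) → 3 ≤ p →
    ∀ (n : ℕ) (G : Graph (Fin n)) → IsTree G →
    ∀ (col : Subset n) → ProperTwoColouring G col →
    ∣ col ∣ ≤ ∣ ∁ col ∣ →
    Σ (Fin n) (λ v → lookup col v ≡ true × IsLeaf G v) →
    IsIndependenceNumber G ∣ ∁ col ∣ →
    ∀ (m : ℕ) → 1 ≤ m →
      (∀ (U : Subset n) →
         ¬ (Split G U ⊑ Join (Complete (∣ col ∣ ∸ 1)) (Edgeless m)))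
      × (∀ (n' : ℕ) (M : Graph (Fin n')) → InDecompFamily (BlowUp p G) M →
         ¬ (M ⊑ Join (Complete (∣ col ∣ ∸ 1)) (Edgeless m)))
lemma2 p _ n G _ col proper _ (v , v∈A , _) α m _ = splitFree , decompositionFree
  where
    host : SlotPartition (Join (Complete (∣ col ∣ ∸ 1)) (Edgeless m)) (∣ col ∣ ∸ 1) 1
    host = completeJoinEdgeless (∣ col ∣ ∸ 1) m
    open BlowingUp p G

    splitFree : ∀ U → ¬ (Split G U ⊑ Join (Complete (∣ col ∣ ∸ 1)) (Edgeless m))
    splitFree U split⊑host = tooFewSlots G col α (v , v∈A) (pull (Split G U) split⊑host host)
      splitOwner search-Split (s≤s (s≤s z≤n)) split-witness
      where open Splitting G U

    -- G^{p+1} ⊆ (M ∪ I_t) ⊗ K_q(t,…,t) with q = χ - 2 ≤ p - 1 classes besides M's.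
    decompositionFree : ∀ n' (M : Graph (Fin n')) → InDecompFamily (BlowUp p G) M →
                        ¬ (M ⊑ Join (Complete (∣ col ∣ ∸ 1)) (Edgeless m))
    decompositionFree _ M (χ , (_ , χ-minimal) , (t , blowUp⊑) , _) M⊑host =
      tooFewSlots G col α (v , v∈A)
        (pull (BlowUp p G) blowUp⊑
           (joinMultipartite (χ ∸ 1 ∸ 1) t (withIsolated t (pull M M⊑host host))))
        blowOwner search-Blow classes<clique blow-witness
      where
        classes<clique : suc (χ ∸ 1 ∸ 1) < 2 + (p ∸ 1)
        classes<clique = s≤s (s≤s (∸-monoˡ-≤ 1 (∸-monoˡ-≤ 1
                           (χ-minimal _ (blowUp-colourable col proper)))))
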